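{- Let $G$ be a finite simple graph with maximum degree $\Delta$. Then $\iota(\mathrm{Mid}(G))\ge \frac{|E(G)|}{2\Delta-1}$.
   Context: For a graph $H$ and $S\subseteq V(H)$, let $N_H[S]$ be $S$ together with all vertices adjacent to a vertex of $S$. A set $S\subseteq V(H)$ is an isolating set of $H$ if $V(H)\setminus N_H[S]$ is an independent set of $H$; $\iota(H)$ is the minimum size of an isolating set of $H$. The middle graph $\mathrm{Mid}(G)$ has vertex set $V(G)\cup\{m_e: e\in E(G)\}$, with $v\sim m_e$ iff $v$ is an endpoint of $e$, $m_e\sim m_f$ iff distinct edges $e,f$ share an endpoint, and no edges between vertices of $V(G)$. -}

module Defs where

open import Data.Nat using (ℕ; zero; suc; _+_; _*_; _∸_; _≤_; _⊔_)
open import Data.Fin using (Fin; splitAt; _≟_)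
open import Data.Fin.Subset using (Subset; _∈_; _∉_; ∣_∣)
open import Data.Product using (Σ; _×_; _,_; proj₁; proj₂; ∃-syntax)
open import Data.Sum using (_⊎_; inj₁; inj₂)
open import Data.Empty using (⊥)
open import Data.List using (List; length; filter; map; foldr; allFin)
open import Relation.Nullary using (¬_; Dec)
open import Relation.Nullary.Decidable using (_⊎-dec_)
open import Relation.Binary.PropositionalEquality using (_≡_; _≢_)

record Graph : Set₁ where
  field
    N   : ℕ
    Adj : Fin N → Fin N → Set

open Graph public

InClosedNbhd : (H : Graph) → Subset (N H) → Fin (N H) → Set
InClosedNbhd H S x = x ∈ S ⊎ (∃[ y ] (y ∈ S × Adj H y x))

IsIsolating : (H : Graph) → Subset (N H) → Set
IsIsolating H S = ∀ x y → ¬ InClosedNbhd H S x → ¬ InClosedNbhd H S y → ¬ Adj H x y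

IsIsolationNumber : (H : Graph) → ℕ → Set
IsIsolationNumber H k =
  (∃[ S ] (IsIsolating H S × ∣ S ∣ ≡ k)) × (∀ S → IsIsolating H S → k ≤ ∣ S ∣)

record SimpleGraph : Set where
  field
    n    : ℕ
    m    : ℕ
    ends : Fin m → Fin n × Fin n
    loopless : ∀ e → proj₁ (ends e) ≢ proj₂ (ends e)
    noMulti  : ∀ e f → e ≢ f →
      ¬ ((proj₁ (ends e) ≡ proj₁ (ends f) × proj₂ (ends e) ≡ proj₂ (ends f)) ⊎
         (proj₁ (ends e) ≡ proj₂ (ends f) × proj₂ (ends e) ≡ proj₁ (ends f)))

open SimpleGraph public

Incident : (G : SimpleGraph) → Fin (n G) → Fin (m G) → Set
Incident G v e = v ≡ proj₁ (ends G e) ⊎ v ≡ proj₂ (ends G e)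

incident? : (G : SimpleGraph) → ∀ v e → Dec (Incident G v e)
incident? G v e = (v ≟ proj₁ (ends G e)) ⊎-dec (v ≟ proj₂ (ends G e))

numEdges : SimpleGraph → ℕ
numEdges G = m G

degree : (G : SimpleGraph) → Fin (n G) → ℕ
degree G v = length (filter (incident? G v) (allFin (m G)))

maxDegree : SimpleGraph → ℕ
maxDegree G = foldr _⊔_ 0 (map (degree G) (allFin (n G)))

ShareEndpoint : (G : SimpleGraph) → Fin (m G) → Fin (m G) → Set
ShareEndpoint G e f = e ≢ f × (∃[ v ] (Incident G v e × Incident G v f))

-- adjacency of the middle graph on vertex set V(G) ⊎ E(G), encoded as Fin (n + m)
MidAdj : (G : SimpleGraph) → Fin (n G + m G) → Fin (n G + m G) → Set
MidAdj G x y with splitAt (n G) x | splitAt (n G) y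
... | inj₁ u | inj₁ v = ⊥
... | inj₁ u | inj₂ f = Incident G u f
... | inj₂ e | inj₁ v = Incident G v e
... | inj₂ e | inj₂ f = ShareEndpoint G e f

Mid : SimpleGraph → Graph
Mid G = record { N = n G + m G ; Adj = MidAdj G }

-- Assign to every edge e = uv of G the two vertices m_e and u of Mid(G). They are adjacent, so an
-- isolating set S must have an element x whose closed neighbourhood meets {m_e, u}; say that x
-- covers e. A vertex x = w of G covers only the edges at w, at most Δ of them; an edge vertex
-- x = m_f with f = ab covers only edges at a or b, at most deg a + deg b − 1 ≤ 2Δ − 1 of them
-- since f itself is counted twice. Every edge being covered, |E(G)| ≤ (2Δ − 1)|S|.
module Submission where

open import Defs
open import Data.Nat.Base using (ℕ; zero; suc; _+_; _*_; _∸_; _⊔_; _≤_; z≤n)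
open import Data.Nat.Properties
open import Algebra.Properties.Semiring.Sum +-*-semiring
  using (sum; ∑-comm; ∑-distrib-+; sum-cong-≗; sum-replicate-zero; *-distribʳ-sum)
open import Data.Bool.Base using (true; false; if_then_else_)
open import Data.Fin using (Fin; zero; suc; splitAt; _↑ˡ_; _↑ʳ_)
open import Data.Fin.Properties using (any?; splitAt-↑ˡ; splitAt-↑ʳ)
open import Data.Fin.Subset using (Subset; _∈_; ∣_∣; inside; outside)
open import Data.Fin.Subset.Properties using (_∈?_)
open import Data.Vec.Base using ([]; _∷_)
open import Data.List.Base using (length; filter; map; foldr; tabulate)
open import Data.Product using (_×_; _,_; proj₁; proj₂; ∃-syntax)
open import Data.Sum using (_⊎_; inj₁; inj₂)
open import Data.Empty using (⊥-elim)
open import Relation.Nullary using (Dec; yes; no; does)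
open import Relation.Nullary.Decidable using (_⊎-dec_; _×-dec_)
open import Relation.Unary using (Pred; Decidable)
open import Relation.Binary.PropositionalEquality
open import Function using (_∘_)

private
  variable
    k s : ℕ

indicator : ∀ {p} {P : Set p} → Dec P → ℕ
indicator d = if does d then 1 else 0

count : ∀ {p} {P : Pred (Fin k) p} → Decidable P → ℕ
count P? = sum (indicator ∘ P?)

sum-mono-≤ : {f g : Fin k → ℕ} → (∀ i → f i ≤ g i) → sum f ≤ sum g
sum-mono-≤ {zero}  f≤g = z≤n
sum-mono-≤ {suc k}  f≤g = +-mono-≤ (f≤g zero) (sum-mono-≤ (f≤g ∘ suc))

sum-const : ∀ k c → sum {k} (λ _ → c) ≡ k * c
sum-const zero    c = refl
sum-const (suc k) c = cong (c +_) (sum-const k c)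

term≤sum : (f : Fin k → ℕ) (i : Fin k) → f i ≤ sum f
term≤sum f zero    = m≤m+n _ _
term≤sum f (suc i) = ≤-trans (term≤sum (f ∘ suc) i) (m≤n+m _ _)

length-filter-tabulate : ∀ {a p} {A : Set a} {P : Pred A p} (P? : Decidable P) (f : Fin k → A) →
  length (filter P? (tabulate f)) ≡ count (P? ∘ f)
length-filter-tabulate {zero}  P? f = refl
length-filter-tabulate {suc k} P? f with does (P? (f zero))
... | true  = cong suc (length-filter-tabulate P? (f ∘ suc))
... | false = length-filter-tabulate P? (f ∘ suc)

≤-foldr-⊔-tabulate : ∀ {a} {A : Set a} (w : A → ℕ) (f : Fin k → A) i →
  w (f i) ≤ foldr _⊔_ 0 (map w (tabulate f))
≤-foldr-⊔-tabulate w f zero    = m≤m⊔n _ _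
≤-foldr-⊔-tabulate w f (suc i) = ≤-trans (≤-foldr-⊔-tabulate w (f ∘ suc) i) (m≤n⊔m _ _)

∣p∣≡count∈ : (S : Subset k) → ∣ S ∣ ≡ count (_∈? S)
∣p∣≡count∈ []            = refl
∣p∣≡count∈ (inside  ∷ S) = cong suc (∣p∣≡count∈ S)
∣p∣≡count∈ (outside ∷ S) = ∣p∣≡count∈ S

1≤count : ∀ {p} {P : Pred (Fin k) p} (P? : Decidable P) {i} → P i → 1 ≤ count P?
1≤count P? {i} Pi = ≤-trans (1≤indicator (P? i)) (term≤sum (indicator ∘ P?) i)
  where
  1≤indicator : (d : Dec _) → 1 ≤ indicator d
  1≤indicator (yes _)  = ≤-refl
  1≤indicator (no ¬Pi) = ⊥-elim (¬Pi Pi)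

count-×-dec+count-⊎-dec : ∀ {p q} {P : Pred (Fin k) p} {Q : Pred (Fin k) q}
  (P? : Decidable P) (Q? : Decidable Q) →
  count (λ i → P? i ×-dec Q? i) + count (λ i → P? i ⊎-dec Q? i) ≡ count P? + count Q?
count-×-dec+count-⊎-dec P? Q? = begin
  count (λ i → P? i ×-dec Q? i) + count (λ i → P? i ⊎-dec Q? i)
    ≡⟨ ∑-distrib-+ (indicator ∘ λ i → P? i ×-dec Q? i) (indicator ∘ λ i → P? i ⊎-dec Q? i) ⟨
  sum (λ i → indicator (P? i ×-dec Q? i) + indicator (P? i ⊎-dec Q? i))
    ≡⟨ sum-cong-≗ pointwise ⟩
  sum (λ i → indicator (P? i) + indicator (Q? i))
    ≡⟨ ∑-distrib-+ (indicator ∘ P?) (indicator ∘ Q?) ⟩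
  count P? + count Q? ∎
  where
  open ≡-Reasoning
  pointwise : ∀ i → indicator (P? i ×-dec Q? i) + indicator (P? i ⊎-dec Q? i)
                  ≡ indicator (P? i) + indicator (Q? i)
  pointwise i with does (P? i) | does (Q? i)
  ... | true  | true  = refl
  ... | true  | false = refl
  ... | false | true  = refl
  ... | false | false = refl

count-×-dec : ∀ {a q} {A : Set a} {Q : Pred (Fin k) q} (d : Dec A) (Q? : Decidable Q) →
  count (λ i → d ×-dec Q? i) ≡ indicator d * count Q?
count-×-dec     (yes _) Q? = sym (+-identityʳ _)
count-×-dec {k} (no _)  Q? = sum-replicate-zero k

covering⇒≤*∣S∣ : ∀ {r} {R : Fin s → Pred (Fin k) r} (R? : ∀ x → Decidable (R x))
  (S : Subset s) {B : ℕ} → (∀ x → count (R? x) ≤ B) →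
  (∀ e → ∃[ x ] (x ∈ S × R x e)) → k ≤ B * ∣ S ∣
covering⇒≤*∣S∣ {s} {k} R? S {B} count≤B covered = begin
  k                                                   ≡⟨ *-identityʳ k ⟨
  k * 1                                               ≡⟨ sum-const k 1 ⟨
  sum {k} (λ e → 1)                                   ≤⟨ sum-mono-≤ coveredOnce ⟩
  sum (λ e → count (λ x → x ∈? S ×-dec R? x e))       ≡⟨ ∑-comm (λ e x → indicator (x ∈? S ×-dec R? x e)) ⟩
  sum (λ x → count (λ e → x ∈? S ×-dec R? x e))       ≡⟨ sum-cong-≗ (λ x → count-×-dec (x ∈? S) (R? x)) ⟩
  sum (λ x → indicator (x ∈? S) * count (R? x))       ≤⟨ sum-mono-≤ (λ x → *-monoʳ-≤ (indicator (x ∈? S)) (count≤B x)) ⟩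
  sum (λ x → indicator (x ∈? S) * B)                  ≡⟨ *-distribʳ-sum B (indicator ∘ (_∈? S)) ⟨
  count (_∈? S) * B                                   ≡⟨ cong (_* B) (∣p∣≡count∈ S) ⟨
  ∣ S ∣ * B                                           ≡⟨ *-comm ∣ S ∣ B ⟩
  B * ∣ S ∣                                           ∎
  where
  open ≤-Reasoning
  coveredOnce : ∀ e → 1 ≤ count (λ x → x ∈? S ×-dec R? x e)
  coveredOnce e = let x , x∈S , Rxe = covered e in 1≤count (λ x → x ∈? S ×-dec R? x e) (x∈S , Rxe)

n≤2*n∸1 : ∀ n → n ≤ 2 * n ∸ 1
n≤2*n∸1 zero    = z≤n
n≤2*n∸1 (suc n) = ≤-trans (m≤m+n (suc n) 0) (m≤n+m (suc n + 0) n)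

closedNbhd⇒∃ : ∀ {c} (H : Graph) (S : Subset (N H)) {y} {C : Pred (Fin (N H)) c} →
  (∀ x → x ≡ y ⊎ Adj H x y → C x) → InClosedNbhd H S y → ∃[ x ] (x ∈ S × C x)
closedNbhd⇒∃ H S C-near (inj₁ y∈S)               = _ , y∈S , C-near _ (inj₁ refl)
closedNbhd⇒∃ H S C-near (inj₂ (x , x∈S , x~y)) = x , x∈S , C-near x (inj₂ x~y)

module _ (G : SimpleGraph) where

  vertex : Fin (n G) → Fin (n G + m G)
  vertex u = u ↑ˡ m G

  edgeVertex : Fin (m G) → Fin (n G + m G)
  edgeVertex e = n G ↑ʳ e

  degree≡count : ∀ v → degree G v ≡ count (incident? G v)
  degree≡count v = length-filter-tabulate (incident? G v) (λ e → e)

  degree≤maxDegree : ∀ v → degree G v ≤ maxDegree G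
  degree≤maxDegree = ≤-foldr-⊔-tabulate (degree G) (λ v → v)

  -- Covers z e holds whenever the closed neighbourhood of z in Mid G meets {m_e, first endpoint of e}.
  Covers : Fin (n G) ⊎ Fin (m G) → Fin (m G) → Set
  Covers (inj₁ u) e = Incident G u e
  Covers (inj₂ f) e = Incident G (proj₁ (ends G f)) e ⊎ Incident G (proj₂ (ends G f)) e

  covers? : ∀ z → Decidable (Covers z)
  covers? (inj₁ u) = incident? G u
  covers? (inj₂ f) e = incident? G (proj₁ (ends G f)) e ⊎-dec incident? G (proj₂ (ends G f)) e

  count-covers≤ : ∀ z → count (covers? z) ≤ 2 * maxDegree G ∸ 1
  count-covers≤ (inj₁ u) = begin
    count (incident? G u) ≡⟨ degree≡count u ⟨
    degree G u            ≤⟨ degree≤maxDegree u ⟩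
    maxDegree G           ≤⟨ n≤2*n∸1 (maxDegree G) ⟩
    2 * maxDegree G ∸ 1   ∎
    where open ≤-Reasoning
  count-covers≤ (inj₂ f) = ∸-monoˡ-≤ 1 (begin
    suc (count A∪B?)                                       ≤⟨ +-monoˡ-≤ (count A∪B?) (1≤count A∩B? f∈A∩B) ⟩
    count A∩B? + count A∪B?                                ≡⟨ count-×-dec+count-⊎-dec A? B? ⟩
    count A? + count B?                                    ≡⟨ cong₂ _+_ (degree≡count a) (degree≡count b) ⟨
    degree G a + degree G b                                ≤⟨ +-mono-≤ (degree≤maxDegree a) (degree≤maxDegree b) ⟩
    maxDegree G + maxDegree G                              ≡⟨ cong (maxDegree G +_) (+-identityʳ (maxDegree G)) ⟨
    2 * maxDegree G                                        ∎)
    where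
    open ≤-Reasoning
    a b : Fin (n G)
    a = proj₁ (ends G f)
    b = proj₂ (ends G f)
    A? : Decidable (Incident G a)
    A? = incident? G a
    B? : Decidable (Incident G b)
    B? = incident? G b
    A∪B? : Decidable (λ e → Incident G a e ⊎ Incident G b e)
    A∪B? e = A? e ⊎-dec B? e
    A∩B? : Decidable (λ e → Incident G a e × Incident G b e)
    A∩B? e = A? e ×-dec B? e
    f∈A∩B : Incident G a f × Incident G b f
    f∈A∩B = inj₁ refl , inj₂ refl

  MidCovers : Fin (n G + m G) → Fin (m G) → Set
  MidCovers x = Covers (splitAt (n G) x)

  midCovers? : ∀ x → Decidable (MidCovers x)
  midCovers? x = covers? (splitAt (n G) x)

  near-edgeVertex⇒covers : ∀ {e} x → x ≡ edgeVertex e ⊎ MidAdj G x (edgeVertex e) → MidCovers x e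
  near-edgeVertex⇒covers {e} _ (inj₁ refl) rewrite splitAt-↑ʳ (n G) (m G) e = inj₁ (inj₁ refl)
  near-edgeVertex⇒covers {e} x (inj₂ x~e)
    with splitAt (n G) x | splitAt (n G) (edgeVertex e) | splitAt-↑ʳ (n G) (m G) e
  ... | inj₁ u | _ | refl = x~e
  ... | inj₂ f | _ | refl with x~e
  ...   | _ , v , inj₁ refl , v∈e = inj₁ v∈e
  ...   | _ , v , inj₂ refl , v∈e = inj₂ v∈e

  near-vertex⇒covers : ∀ {u e} → Incident G u e → ∀ x → x ≡ vertex u ⊎ MidAdj G x (vertex u) → MidCovers x e
  near-vertex⇒covers {u} u∈e _ (inj₁ refl) rewrite splitAt-↑ˡ (n G) u (m G) = u∈e
  near-vertex⇒covers {u} u∈e x (inj₂ x~u)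
    with splitAt (n G) x | splitAt (n G) (vertex u) | splitAt-↑ˡ (n G) u (m G)
  ... | inj₁ w | _ | refl = ⊥-elim x~u
  ... | inj₂ f | _ | refl with x~u
  ...   | inj₁ refl = inj₁ u∈e
  ...   | inj₂ refl = inj₂ u∈e

  edgeVertex~vertex : ∀ {u e} → Incident G u e → MidAdj G (edgeVertex e) (vertex u)
  edgeVertex~vertex {u} {e} u∈e rewrite splitAt-↑ʳ (n G) (m G) e | splitAt-↑ˡ (n G) u (m G) = u∈e

  isolating⇒covering : ∀ S → IsIsolating (Mid G) S → ∀ e → ∃[ x ] (x ∈ S × MidCovers x e)
  isolating⇒covering S isolating e with any? (λ x → x ∈? S ×-dec midCovers? x e)
  ... | yes covered   = covered
  ... | no uncovered = ⊥-elim (isolating (edgeVertex e) (vertex a)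
    (uncovered ∘ closedNbhd⇒∃ (Mid G) S near-edgeVertex⇒covers)
    (uncovered ∘ closedNbhd⇒∃ (Mid G) S (near-vertex⇒covers a∈e))
    (edgeVertex~vertex a∈e))
    where
    a = proj₁ (ends G e)
    a∈e : Incident G a e
    a∈e = inj₁ refl

proposition6 : (G : SimpleGraph) (k : ℕ) → IsIsolationNumber (Mid G) k →
    numEdges G ≤ (2 * maxDegree G ∸ 1) * k
proposition6 G _ ((S , isolating , refl) , _) =
  covering⇒≤*∣S∣ (midCovers? G) S (count-covers≤ G ∘ splitAt (n G)) (isolating⇒covering G S isolating)
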